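{- Let $t$ and $s$ be de Bruijn terms such that $t\rhd_\beta^* s$. Then $t\rhd_{rm\beta_s}^* s$.
   Context: Suspension calculus without meta variables. Terms $t ::= c \mid \#i \mid (t\ t)\mid(\lambda\, t)\mid [\![t,n,n,e]\!]$, environments $e::= nil\mid ((t,n)::e)\mid \{\!\{e,n,n,e\}\!\}$ ($c$ constants, $n$ naturals, $i$ positive integers). $m\mathbin{\dot- } n=\max(m-n,0)$. Well-formedness (required of all expressions): every subexpression $[\![t,ol,nl,e]\!]$ has $len(e)=ol$, $lev(e)\le nl$; $(t,l)::e$ has $l\ge lev(e)$; $\{\!\{e_1,nl_1,ol_2,e_2\}\!\}$ has $lev(e_1)\le nl_1$, $len(e_2)=ol_2$; where $len(nil)=0$, $len((t,l)::e)=1+len(e)$, $len(\{\!\{e_1,nl_1,ol_2,e_2\}\!\})=len(e_1)+(len(e_2)\mathbin{\dot- } nl_1)$, $lev(nil)=0$, $lev((t,l)::e)=l$, $lev(\{\!\{e_1,nl_1,ol_2,e_2\}\!\})=lev(e_2)+(nl_1\mathbin{\dot- } ol_2)$. Rules: $(\beta_s)$ $((\lambda t_1)\ t_2)\to[\![t_1,1,0,(t_2,0)::nil]\!]$; (r1) $[\![c,ol,nl,e]\!]\to c$; (r2) $[\![\#i,0,nl,nil]\!]\to\#(i+nl)$; (r3) $[\![\#1,ol,nl,(t,l)::e]\!]\to[\![t,0,nl-l,nil]\!]$; (r4) $[\![\#i,ol,nl,(t,l)::e]\!]\to[\![\#(i-1),ol-1,nl,e]\!]$ if $i>1$; (r5)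 $[\![(t_1\ t_2),ol,nl,e]\!]\to([\![t_1,ol,nl,e]\!]\ [\![t_2,ol,nl,e]\!])$; (r6) $[\![(\lambda t),ol,nl,e]\!]\to(\lambda [\![t,ol+1,nl+1,(\#1,nl+1)::e]\!])$; (m1) $[\![[\![t,ol_1,nl_1,e_1]\!],ol_2,nl_2,e_2]\!]\to[\![t,ol_1+(ol_2\mathbin{\dot- } nl_1),nl_2+(nl_1\mathbin{\dot- } ol_2),\{\!\{e_1,nl_1,ol_2,e_2\}\!\}]\!]$; (m2) $\{\!\{e_1,nl_1,0,nil\}\!\}\to e_1$; (m3) $\{\!\{nil,0,ol_2,e_2\}\!\}\to e_2$; (m4) $\{\!\{nil,nl_1,ol_2,(t,l)::e_2\}\!\}\to\{\!\{nil,nl_1-1,ol_2-1,e_2\}\!\}$ if $nl_1\ge1$; (m5) $\{\!\{(t,n)::e_1,nl_1,ol_2,(s,l)::e_2\}\!\}\to\{\!\{(t,n)::e_1,nl_1-1,ol_2-1,e_2\}\!\}$ if $nl_1>n$; (m6) $\{\!\{(t,n)::e_1,n,ol_2,(s,l)::e_2\}\!\}\to([\![t,ol_2,l,(s,l)::e_2]\!],l+(n\mathbin{\dot- } ol_2))::\{\!\{e_1,n,ol_2,(s,l)::e_2\}\!\}$. $x\rhd_{rm\beta_s}y$: $y$ results from $x$ by any one of these rules at some subexpression; $\rhd_{rm\beta_s}^*$ is its reflexive–transitive closure. De Bruijn terms are terms built only from constants, $\#i$, application and abstraction (no suspensions). For de Bruijn terms: $S(c;s_1,s_2,\dots)=c$;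 $S(\#i;s_1,s_2,\dots)=s_i$; $S((t_1\ t_2);\bar s)=(S(t_1;\bar s)\ S(t_2;\bar s))$; $S((\lambda t);s_1,s_2,\dots)=(\lambda\, S(t;\#1,s_1',s_2',\dots))$ with $s_i'=S(s_i;\#2,\#3,\dots)$. $t\rhd_\beta s$ means $s$ results from $t$ by replacing a subterm $((\lambda t_1)\ t_2)$ by $S(t_1;t_2,\#1,\#2,\dots)$; $\rhd_\beta^*$ is its reflexive–transitive closure. -}

module Defs where

open import Data.Nat using (ℕ; zero; suc; _+_; _∸_; _≤_; _<_)
open import Relation.Binary.PropositionalEquality using (_≡_)
open import Relation.Binary.Construct.Closure.ReflexiveTransitive using (Star)

-- Constants are named by natural numbers.
-- ENCODING: a variable index #i (i positive) is written  var k  with  i = k + 1.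

mutual
  data Term : Set where
    con  : ℕ → Term
    var  : ℕ → Term
    app  : Term → Term → Term
    lam  : Term → Term
    susp : Term → ℕ → ℕ → Env → Term

  data Env : Set where
    nil  : Env
    cons : Term → ℕ → Env → Env
    comp : Env → ℕ → ℕ → Env → Env

len : Env → ℕ
len nil = 0
len (cons t l e) = suc (len e)
len (comp e₁ nl₁ ol₂ e₂) = len e₁ + (len e₂ ∸ nl₁)

lev : Env → ℕ
lev nil = 0
lev (cons t l e) = l
lev (comp e₁ nl₁ ol₂ e₂) = lev e₂ + (nl₁ ∸ ol₂)

mutual
  data WFT : Term → Set where
    wf-con  : ∀ {c} → WFT (con c)
    wf-var  : ∀ {k} → WFT (var k)
    wf-app  : ∀ {t₁ t₂} → WFT t₁ → WFT t₂ → WFT (app t₁ t₂)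
    wf-lam  : ∀ {t} → WFT t → WFT (lam t)
    wf-susp : ∀ {t ol nl e} → WFT t → WFE e →
              len e ≡ ol → lev e ≤ nl → WFT (susp t ol nl e)

  data WFE : Env → Set where
    wf-nil  : WFE nil
    wf-cons : ∀ {t l e} → WFT t → WFE e → lev e ≤ l → WFE (cons t l e)
    wf-comp : ∀ {e₁ nl₁ ol₂ e₂} → WFE e₁ → WFE e₂ →
              lev e₁ ≤ nl₁ → len e₂ ≡ ol₂ → WFE (comp e₁ nl₁ ol₂ e₂)

mutual
  data _⟶T_ : Term → Term → Set where
    βs : ∀ {t₁ t₂} →
         app (lam t₁) t₂ ⟶T susp t₁ 1 0 (cons t₂ 0 nil)
    r1 : ∀ {c ol nl e} → susp (con c) ol nl e ⟶T con c
    r2 : ∀ {k nl} → susp (var k) 0 nl nil ⟶T var (k + nl)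
    r3 : ∀ {ol nl t l e} →
         susp (var 0) ol nl (cons t l e) ⟶T susp t 0 (nl ∸ l) nil
    r4 : ∀ {k ol nl t l e} →
         susp (var (suc k)) ol nl (cons t l e) ⟶T susp (var k) (ol ∸ 1) nl e
    r5 : ∀ {t₁ t₂ ol nl e} →
         susp (app t₁ t₂) ol nl e ⟶T app (susp t₁ ol nl e) (susp t₂ ol nl e)
    r6 : ∀ {t ol nl e} →
         susp (lam t) ol nl e ⟶T
           lam (susp t (suc ol) (suc nl) (cons (var 0) (suc nl) e))
    m1 : ∀ {t ol₁ nl₁ e₁ ol₂ nl₂ e₂} →
         susp (susp t ol₁ nl₁ e₁) ol₂ nl₂ e₂ ⟶T
           susp t (ol₁ + (ol₂ ∸ nl₁)) (nl₂ + (nl₁ ∸ ol₂)) (comp e₁ nl₁ ol₂ e₂)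
    app-l  : ∀ {t₁ t₁' t₂} → t₁ ⟶T t₁' → app t₁ t₂ ⟶T app t₁' t₂
    app-r  : ∀ {t₁ t₂ t₂'} → t₂ ⟶T t₂' → app t₁ t₂ ⟶T app t₁ t₂'
    lam-c  : ∀ {t t'} → t ⟶T t' → lam t ⟶T lam t'
    susp-t : ∀ {t t' ol nl e} → t ⟶T t' → susp t ol nl e ⟶T susp t' ol nl e
    susp-e : ∀ {t ol nl e e'} → e ⟶E e' → susp t ol nl e ⟶T susp t ol nl e'

  data _⟶E_ : Env → Env → Set where
    m2 : ∀ {e₁ nl₁} → comp e₁ nl₁ 0 nil ⟶E e₁
    m3 : ∀ {ol₂ e₂} → comp nil 0 ol₂ e₂ ⟶E e₂
    m4 : ∀ {nl₁ ol₂ t l e₂} → 1 ≤ nl₁ →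
         comp nil nl₁ ol₂ (cons t l e₂) ⟶E comp nil (nl₁ ∸ 1) (ol₂ ∸ 1) e₂
    m5 : ∀ {t n e₁ nl₁ ol₂ s l e₂} → n < nl₁ →
         comp (cons t n e₁) nl₁ ol₂ (cons s l e₂) ⟶E
           comp (cons t n e₁) (nl₁ ∸ 1) (ol₂ ∸ 1) e₂
    m6 : ∀ {t n e₁ ol₂ s l e₂} →
         comp (cons t n e₁) n ol₂ (cons s l e₂) ⟶E
           cons (susp t ol₂ l (cons s l e₂)) (l + (n ∸ ol₂))
                (comp e₁ n ol₂ (cons s l e₂))
    cons-t : ∀ {t t' l e} → t ⟶T t' → cons t l e ⟶E cons t' l e
    cons-e : ∀ {t l e e'} → e ⟶E e' → cons t l e ⟶E cons t l e'
    comp-l : ∀ {e₁ e₁' nl₁ ol₂ e₂} → e₁ ⟶E e₁' →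
             comp e₁ nl₁ ol₂ e₂ ⟶E comp e₁' nl₁ ol₂ e₂
    comp-r : ∀ {e₁ nl₁ ol₂ e₂ e₂'} → e₂ ⟶E e₂' →
             comp e₁ nl₁ ol₂ e₂ ⟶E comp e₁ nl₁ ol₂ e₂'

data _▷rmβs_ (x y : Term) : Set where
  step : WFT x → WFT y → x ⟶T y → x ▷rmβs y

_▷rmβs*_ : Term → Term → Set
_▷rmβs*_ = Star _▷rmβs_

data DB : Set where
  con : ℕ → DB
  var : ℕ → DB
  app : DB → DB → DB
  lam : DB → DB

⌜_⌝ : DB → Term
⌜ con c ⌝ = con c
⌜ var k ⌝ = var k
⌜ app t₁ t₂ ⌝ = app ⌜ t₁ ⌝ ⌜ t₂ ⌝
⌜ lam t ⌝ = lam ⌜ t ⌝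

-- Renaming: ren f t = S(t; #(f 0 + 1), #(f 1 + 1), ...)  (specialisation of S
-- to variable-only sequences, needed to make S structurally recursive)
liftR : (ℕ → ℕ) → ℕ → ℕ
liftR f zero = zero
liftR f (suc k) = suc (f k)

ren : (ℕ → ℕ) → DB → DB
ren f (con c) = con c
ren f (var k) = var (f k)
ren f (app t₁ t₂) = app (ren f t₁) (ren f t₂)
ren f (lam t) = lam (ren (liftR f) t)

-- Sequences s₁, s₂, ... are represented as  s : ℕ → DB  with  s k = s_{k+1}.
liftS : (ℕ → DB) → ℕ → DB
liftS s zero = var zero
liftS s (suc k) = ren suc (s k)

S : DB → (ℕ → DB) → DB
S (con c) s = con c
S (var k) s = s k
S (app t₁ t₂) s = app (S t₁ s) (S t₂ s)
S (lam t) s = lam (S t (liftS s))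

βseq : DB → ℕ → DB
βseq t₂ zero = t₂
βseq t₂ (suc k) = var k

data _▷β_ : DB → DB → Set where
  beta  : ∀ {t₁ t₂} → app (lam t₁) t₂ ▷β S t₁ (βseq t₂)
  app-l : ∀ {t₁ t₁' t₂} → t₁ ▷β t₁' → app t₁ t₂ ▷β app t₁' t₂
  app-r : ∀ {t₁ t₂ t₂'} → t₂ ▷β t₂' → app t₁ t₂ ▷β app t₁ t₂'
  lam-c : ∀ {t t'} → t ▷β t' → lam t ▷β lam t'

_▷β*_ : DB → DB → Set
_▷β*_ = Star _▷β_

-- A suspension [[t, ol, nl, e]] over a de Bruijn term t is evaluated by pushing it
-- inwards with (r1)–(r6). This computes S(t; σ) provided every variable #k under e
-- computes σ_k — uniformly in how far nl has been raised beyond its original value,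
-- the excess d showing up as a shift of σ_k by d. That invariant holds for nil and
-- for the (β_s) environment (t₂, 0) :: nil, and is preserved by the environment
-- (#1, nl + 1) :: e that (r6) creates; so every β-step is simulated by (β_s)
-- followed by (r1)–(r6) alone, without ever composing environments.
module Submission where

open import Defs
open import Data.Nat using (ℕ; zero; suc; _+_; _∸_; _≤_; z≤n; s≤s)
open import Data.Nat.Properties using (+-suc; +-identityʳ; +-assoc; m+n∸m≡n; m≤m+n; ≤-refl; ≤-trans; m≤n⇒m≤1+n)
open import Function using (_∘_; id)
open import Relation.Binary.PropositionalEquality using (_≡_; _≗_; refl; sym; trans; cong; cong₂; subst; subst₂)
open import Relation.Binary.Construct.Closure.ReflexiveTransitive using (_◅◅_; gmap; kleisliStar; return)

liftR-cong : ∀ {f g : ℕ → ℕ} → f ≗ g → liftR f ≗ liftR g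
liftR-cong f≗g zero    = refl
liftR-cong f≗g (suc k) = cong suc (f≗g k)

ren-cong : ∀ {f g : ℕ → ℕ} → f ≗ g → ren f ≗ ren g
ren-cong f≗g (con c)   = refl
ren-cong f≗g (var k)   = cong var (f≗g k)
ren-cong f≗g (app t u) = cong₂ app (ren-cong f≗g t) (ren-cong f≗g u)
ren-cong f≗g (lam t)   = cong lam (ren-cong (liftR-cong f≗g) t)

liftR-∘ : ∀ (f g : ℕ → ℕ) → liftR f ∘ liftR g ≗ liftR (f ∘ g)
liftR-∘ f g zero    = refl
liftR-∘ f g (suc k) = refl

ren-∘ : ∀ (f g : ℕ → ℕ) → ren f ∘ ren g ≗ ren (f ∘ g)
ren-∘ f g (con c)   = refl
ren-∘ f g (var k)   = refl
ren-∘ f g (app t u) = cong₂ app (ren-∘ f g t) (ren-∘ f g u)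
ren-∘ f g (lam t)   = cong lam (trans (ren-∘ (liftR f) (liftR g) t) (ren-cong (liftR-∘ f g) t))

liftR-id : ∀ {f : ℕ → ℕ} → f ≗ id → liftR f ≗ id
liftR-id f≗id zero    = refl
liftR-id f≗id (suc k) = cong suc (f≗id k)

ren-id : ∀ {f : ℕ → ℕ} → f ≗ id → ren f ≗ id
ren-id f≗id (con c)   = refl
ren-id f≗id (var k)   = cong var (f≗id k)
ren-id f≗id (app t u) = cong₂ app (ren-id f≗id t) (ren-id f≗id u)
ren-id f≗id (lam t)   = cong lam (ren-id (liftR-id f≗id) t)

liftS-cong : ∀ {σ τ : ℕ → DB} → σ ≗ τ → liftS σ ≗ liftS τ
liftS-cong σ≗τ zero    = refl
liftS-cong σ≗τ (suc k) = cong (ren suc) (σ≗τ k)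

S-cong : ∀ {σ τ : ℕ → DB} → σ ≗ τ → ∀ t → S t σ ≡ S t τ
S-cong σ≗τ (con c)   = refl
S-cong σ≗τ (var k)   = σ≗τ k
S-cong σ≗τ (app t u) = cong₂ app (S-cong σ≗τ t) (S-cong σ≗τ u)
S-cong σ≗τ (lam t)   = cong lam (S-cong (liftS-cong σ≗τ) t)

liftS-var : ∀ (f : ℕ → ℕ) → liftS (var ∘ f) ≗ var ∘ liftR f
liftS-var f zero    = refl
liftS-var f (suc k) = refl

S-var≡ren : ∀ (f : ℕ → ℕ) t → S t (var ∘ f) ≡ ren f t
S-var≡ren f (con c)   = refl
S-var≡ren f (var k)   = refl
S-var≡ren f (app t u) = cong₂ app (S-var≡ren f t) (S-var≡ren f u)
S-var≡ren f (lam t)   = cong lam (trans (S-cong (liftS-var f) t) (S-var≡ren (liftR f) t))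

⌜⌝-wf : ∀ t → WFT ⌜ t ⌝
⌜⌝-wf (con c)   = wf-con
⌜⌝-wf (var k)   = wf-var
⌜⌝-wf (app t u) = wf-app (⌜⌝-wf t) (⌜⌝-wf u)
⌜⌝-wf (lam t)   = wf-lam (⌜⌝-wf t)

single : ∀ {x y} → WFT x → WFT y → x ⟶T y → x ▷rmβs* y
single wx wy x⟶y = return (step wx wy x⟶y)

app-l* : ∀ {a a' b} → WFT b → a ▷rmβs* a' → app a b ▷rmβs* app a' b
app-l* wb = gmap (λ a → app a _) λ { (step wx wy r) → step (wf-app wx wb) (wf-app wy wb) (app-l r) }

app-r* : ∀ {a b b'} → WFT a → b ▷rmβs* b' → app a b ▷rmβs* app a b'
app-r* wa = gmap (app _) λ { (step wx wy r) → step (wf-app wa wx) (wf-app wa wy) (app-r r) }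

lam* : ∀ {a a'} → a ▷rmβs* a' → lam a ▷rmβs* lam a'
lam* = gmap lam λ { (step wx wy r) → step (wf-lam wx) (wf-lam wy) (lam-c r) }

record Represents (ol nl : ℕ) (e : Env) (σ : ℕ → DB) : Set where
  field
    wf-env  : WFE e
    len≡ol  : len e ≡ ol
    lev≤nl  : lev e ≤ nl
    var-red : ∀ d k → susp (var k) ol (nl + d) e ▷rmβs* ⌜ ren (_+ d) (σ k) ⌝

  wf-susp-under : ∀ {t} → WFT t → WFT (susp t ol nl e)
  wf-susp-under wt = wf-susp wt wf-env len≡ol lev≤nl

  var-red₀ : ∀ k → susp (var k) ol nl e ▷rmβs* ⌜ σ k ⌝
  var-red₀ k = subst₂ (λ n u → susp (var k) ol n e ▷rmβs* ⌜ u ⌝)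
    (+-identityʳ nl) (ren-id +-identityʳ (σ k)) (var-red 0 k)
open Represents

wf-susp-nil : ∀ {t nl} → WFT t → WFT (susp t 0 nl nil)
wf-susp-nil wt = wf-susp wt wf-nil refl z≤n

nil-represents : ∀ nl → Represents 0 nl nil (λ k → var (k + nl))
nil-represents nl = record
  { wf-env = wf-nil ; len≡ol = refl ; lev≤nl = z≤n
  ; var-red = λ d k → subst (λ v → susp (var k) 0 (nl + d) nil ▷rmβs* var v)
      (sym (+-assoc k nl d)) (single (wf-susp-nil wf-var) wf-var r2) }

lift-represents : ∀ {ol nl e σ} → Represents ol nl e σ →
  Represents (suc ol) (suc nl) (cons (var 0) (suc nl) e) (liftS σ)
lift-represents {ol} {nl} {e} {σ} R = record
  { wf-env = wf-e' ; len≡ol = cong suc (len≡ol R) ; lev≤nl = ≤-refl ; var-red = red }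
  where
  wf-e' : WFE (cons (var 0) (suc nl) e)
  wf-e' = wf-cons wf-var (wf-env R) (m≤n⇒m≤1+n (lev≤nl R))
  wf-var-under : ∀ d {k} → WFT (susp (var k) (suc ol) (suc nl + d) (cons (var 0) (suc nl) e))
  wf-var-under d = wf-susp wf-var wf-e' (cong suc (len≡ol R)) (s≤s (m≤m+n nl d))
  shift-suc : ∀ d k → ren (_+ suc d) (σ k) ≡ ren (_+ d) (ren suc (σ k))
  shift-suc d k = trans (ren-cong (λ j → +-suc j d) (σ k)) (sym (ren-∘ (_+ d) suc (σ k)))
  red : ∀ d k → susp (var k) (suc ol) (suc nl + d) (cons (var 0) (suc nl) e)
                ▷rmβs* ⌜ ren (_+ d) (liftS σ k) ⌝
  red d zero = single (wf-var-under d) (wf-susp-nil wf-var) r3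
    ◅◅ subst (λ u → susp (var 0) 0 (suc nl + d ∸ suc nl) nil ▷rmβs* var u) (m+n∸m≡n (suc nl) d)
         (single (wf-susp-nil wf-var) wf-var r2)
  red d (suc k) = single (wf-var-under d) wf-var-raised r4
    ◅◅ subst₂ (λ n u → susp (var k) ol n e ▷rmβs* ⌜ u ⌝) (+-suc nl d) (shift-suc d k)
         (var-red R (suc d) k)
    where
    wf-var-raised : WFT (susp (var k) ol (suc (nl + d)) e)
    wf-var-raised = wf-susp wf-var (wf-env R) (len≡ol R) (m≤n⇒m≤1+n (≤-trans (lev≤nl R) (m≤m+n nl d)))

susp-red-S : ∀ {ol nl e σ} → Represents ol nl e σ → ∀ t → susp ⌜ t ⌝ ol nl e ▷rmβs* ⌜ S t σ ⌝
susp-red-S R (con c)   = single (wf-susp-under R wf-con) wf-con r1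
susp-red-S R (var k)   = var-red₀ R k
susp-red-S R (app t u) =
  single (wf-susp-under R (⌜⌝-wf (app t u)))
         (wf-app (wf-susp-under R (⌜⌝-wf t)) (wf-susp-under R (⌜⌝-wf u))) r5
  ◅◅ app-l* (wf-susp-under R (⌜⌝-wf u)) (susp-red-S R t)
  ◅◅ app-r* (⌜⌝-wf (S t _)) (susp-red-S R u)
susp-red-S {ol} {nl} {e} {σ} R (lam t) =
  single (wf-susp-under R (⌜⌝-wf (lam t))) (wf-lam (wf-susp-under R' (⌜⌝-wf t))) r6
  ◅◅ lam* (susp-red-S R' t)
  where
  R' : Represents (suc ol) (suc nl) (cons (var 0) (suc nl) e) (liftS σ)
  R' = lift-represents R

β-represents : ∀ t₂ → Represents 1 0 (cons ⌜ t₂ ⌝ 0 nil) (βseq t₂)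
β-represents t₂ = record { wf-env = wf-e ; len≡ol = refl ; lev≤nl = z≤n ; var-red = red }
  where
  wf-e : WFE (cons ⌜ t₂ ⌝ 0 nil)
  wf-e = wf-cons (⌜⌝-wf t₂) wf-nil z≤n
  red : ∀ d k → susp (var k) 1 d (cons ⌜ t₂ ⌝ 0 nil) ▷rmβs* ⌜ ren (_+ d) (βseq t₂ k) ⌝
  red d zero = single (wf-susp wf-var wf-e refl z≤n) (wf-susp-nil (⌜⌝-wf t₂)) r3
    ◅◅ subst (λ v → susp ⌜ t₂ ⌝ 0 d nil ▷rmβs* ⌜ v ⌝) (S-var≡ren (_+ d) t₂)
         (susp-red-S (nil-represents d) t₂)
  red d (suc k) = single (wf-susp wf-var wf-e refl z≤n) (wf-susp-nil wf-var) r4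
    ◅◅ single (wf-susp-nil wf-var) wf-var r2

▷β⇒▷rmβs* : ∀ {t s} → t ▷β s → ⌜ t ⌝ ▷rmβs* ⌜ s ⌝
▷β⇒▷rmβs* (beta {t₁} {t₂}) =
  single (⌜⌝-wf (app (lam t₁) t₂)) (wf-susp-under R (⌜⌝-wf t₁)) βs ◅◅ susp-red-S R t₁
  where
  R : Represents 1 0 (cons ⌜ t₂ ⌝ 0 nil) (βseq t₂)
  R = β-represents t₂
▷β⇒▷rmβs* (app-l {t₂ = t₂} r) = app-l* (⌜⌝-wf t₂) (▷β⇒▷rmβs* r)
▷β⇒▷rmβs* (app-r {t₁ = t₁} r) = app-r* (⌜⌝-wf t₁) (▷β⇒▷rmβs* r)
▷β⇒▷rmβs* (lam-c r)           = lam* (▷β⇒▷rmβs* r)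

theorem3p21 : (t s : DB) → t ▷β* s → ⌜ t ⌝ ▷rmβs* ⌜ s ⌝
theorem3p21 _ _ = kleisliStar ⌜_⌝ ▷β⇒▷rmβs*
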